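{- Let $d$ be a positive integer, let $G=(V,E)$ be a finite graph, and let $f:F\to\mathbb{Z}_d$ be a labeling of a subset $F\subseteq E$ of its edges. If the subgraph $H$ of $G$ consisting of the edges in $F$ and their endpoints, labeled with $f$, is compatible, then there is an extension $f_E:E\to\mathbb{Z}_d$ of $f$ such that $(G,f_E)$ is compatible.
   Context: $\mathbb{Z}_d$ denotes the integers modulo $d$. A cycle of length $k$ is a closed walk, not necessarily simple, with edges $e_1,\dots,e_k$, $e_i=(v_i,v_{i+1})$ for $i<k$, $e_k=(v_k,v_1)$. For an e-labeled graph with labeling $g$: even cycle property means every cycle of even length with edges $e_1,\dots,e_{2k}$ satisfies $\sum_{l\text{ odd}}g(e_l)\equiv\sum_{l\text{ even}}g(e_l)\pmod d$; odd cycle property ($d$ even) means every cycle of odd length with edges $e_1,\dots,e_{2k+1}$ satisfies $\frac d2\sum_l g(e_l)\equiv0\pmod d$; compatible means $d$ odd and the even cycle property holds, or $d$ even and both properties hold. -}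

module Defs where

open import Data.Nat using (ℕ; _≤_; zero; suc; _+_; _*_; _/_; _%_; NonZero)
open import Data.Fin using (Fin; toℕ)
open import Data.List using (List; []; _∷_; length)
open import Data.List.Relation.Binary.Pointwise using (Pointwise)
open import Data.Maybe using (Maybe; just)
open import Data.Product using (_×_)
open import Data.Sum using (_⊎_)
open import Relation.Binary.PropositionalEquality using (_≡_; _≢_)

record Graph : Set where
  field
    n m     : ℕ
    src tgt : Fin m → Fin n
    noLoop  : ∀ e → src e ≢ tgt e
    noMulti : ∀ e e′ → ((src e′ ≡ src e × tgt e′ ≡ tgt e) ⊎ (src e′ ≡ tgt e × tgt e′ ≡ src e)) → e ≡ e′

module _ (G : Graph) where
  open Graph G

  Joins : Fin m → Fin n → Fin n → Set
  Joins e u w = (src e ≡ u × tgt e ≡ w) ⊎ (src e ≡ w × tgt e ≡ u)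

  data Walk : Fin n → Fin n → List (Fin m) → Set where
    nil  : ∀ {v} → Walk v v []
    cons : ∀ {u w x e es} → Joins e u w → Walk w x es → Walk u x (e ∷ es)

-- sums of labels at odd (1st, 3rd, …) and even (2nd, 4th, …) positions
oddSum evenSum : ∀ {d} → List (Fin d) → ℕ
oddSum []       = 0
oddSum (x ∷ xs) = toℕ x + evenSum xs
evenSum []       = 0
evenSum (x ∷ xs) = oddSum xs

labelSum : ∀ {d} → List (Fin d) → ℕ
labelSum []       = 0
labelSum (x ∷ xs) = toℕ x + labelSum xs

-- A partial labeling f : E → Maybe ℤ_d encodes a labeling of the subset
-- F = {e | f e ≢ nothing}.  The labeled graph consists of the edges of F
-- (and their endpoints); its cycles are the closed walks of G using only
-- edges of F, with label list ls.
module _ (G : Graph) (d : ℕ) .{{_ : NonZero d}} where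
  open Graph G

  EvenCycleProperty : (Fin m → Maybe (Fin d)) → Set
  EvenCycleProperty f =
    ∀ (v : Fin n) (es : List (Fin m)) (ls : List (Fin d)) →
    Walk G v v es → 1 ≤ length es → length es % 2 ≡ 0 →
    Pointwise (λ e l → f e ≡ just l) es ls →
    oddSum ls % d ≡ evenSum ls % d

  OddCycleProperty : (Fin m → Maybe (Fin d)) → Set
  OddCycleProperty f =
    ∀ (v : Fin n) (es : List (Fin m)) (ls : List (Fin d)) →
    Walk G v v es → length es % 2 ≡ 1 →
    Pointwise (λ e l → f e ≡ just l) es ls →
    ((d / 2) * labelSum ls) % d ≡ 0

  Compatible : (Fin m → Maybe (Fin d)) → Set
  Compatible f =
    (d % 2 ≡ 1 × EvenCycleProperty f) ⊎
    (d % 2 ≡ 0 × EvenCycleProperty f × OddCycleProperty f)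

-- Call π : V → ℤ a potential for a partial labelling f when every
-- labelled edge e = uw has f(e) ≡ π(u) + π(w) (mod d).  A potential gives the
-- total labelling fE(uw) = π(u) + π(w) mod d, which extends f and is
-- compatible: along any walk v → x the alternating label sum telescopes to
-- π(v) ∓ π(x), and the total label sum is π(v) + π(x) plus an even number.
-- So it suffices to build a potential for a compatible f.  In each component of
-- the labelled subgraph H choose a root ρ, an H-walk W_x from ρ to every x, and
-- a T with 2T ≡ alt(C) for every odd closed H-walk C at ρ (2 is invertible when
-- d is odd; the odd cycle property makes the label sum of C even when d is even;
-- the choice of C is irrelevant by the even cycle property).  Then
-- π(x) = (−1)^|W_x| (T − alt(W_x)) is a potential, by the even cycle property
-- applied to the closed walks W_u · e · W_w⁻¹.
module Submission where

open import Defs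
open import Data.Bool using (Bool; true; false; not; _xor_; if_then_else_)
open import Data.Bool.Properties using (not-involutive; not-distribˡ-xor) renaming (_≟_ to _≟ᵇ_)
open import Data.Fin as Fin using (Fin; toℕ)
import Data.Fin.Properties as FinP
open import Data.Integer as ℤ using (ℤ; +_; -[1+_]; _+_; _*_; -_; _-_)
import Data.Integer.Properties as ℤP
open import Data.Integer.DivMod using (a≡a%ℕn+[a/ℕn]*n)
open import Data.Integer.Tactic.RingSolver using (solve-∀)
open import Data.List using (List; []; _∷_; length; allFin; cartesianProduct)
open import Data.List.Membership.Propositional.Properties using (∈-allFin; ∈-cartesianProduct⁺)
open import Data.List.Membership.Propositional using (_∈_)
open import Data.List.Relation.Binary.Pointwise using (Pointwise; []; _∷_)
open import Data.List.Relation.Unary.All as All using (All; all?)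
open import Data.List.Relation.Unary.All.Properties using (¬All⇒Any¬)
open import Data.List.Relation.Unary.Any as Any using (Any; here; there)
open import Data.Maybe as Maybe using (Maybe; just; nothing; is-just; _<∣>_)
open import Data.Maybe.Properties using (just-injective)
open import Data.Nat as ℕ using (ℕ; zero; suc; NonZero; _≤_; _<_; z≤n; s≤s)
import Data.Nat.Properties as ℕP
open import Data.Nat.Divisibility using (_∣_; m%n≡0⇒n∣m; *-cancelˡ-∣)
open import Data.Nat.DivMod using (_mod_; m≡m%n+[m/n]*n; [m+kn]%n≡m%n; [m+n]%n≡m%n; m%n%n≡m%n; m<n⇒m%n≡m)
open import Data.Product using (Σ; _×_; _,_; proj₁; proj₂)
open import Data.Sum using (_⊎_; inj₁; inj₂)
open import Function using (_∘_)
open import Relation.Binary.Bundles using (Setoid)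
import Relation.Binary.Reasoning.Setoid
open import Relation.Nullary using (Dec; yes; no; ¬_; contradiction)
open import Relation.Nullary.Decidable using (_→-dec_)
open import Relation.Binary.PropositionalEquality

module Congruence (d : ℕ) .{{_ : NonZero d}} where

  D : ℤ
  D = + d

  infix 4 _≈_
  data _≈_ (x y : ℤ) : Set where
    ≈-by : (k : ℤ) → x ≡ y + k * D → x ≈ y

  private
    plus-zero : ∀ x D → x ≡ x + + 0 * D
    plus-zero = solve-∀
    undo : ∀ y k D → y ≡ (y + k * D) + (- k) * D
    undo = solve-∀
    collect : ∀ z k k′ D → (z + k′ * D) + k * D ≡ z + (k + k′) * D
    collect = solve-∀
    add : ∀ x y k k′ D → (x + k * D) + (y + k′ * D) ≡ (x + y) + (k + k′) * D
    add = solve-∀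
    scale : ∀ c y k D → c * (y + k * D) ≡ c * y + (c * k) * D
    scale = solve-∀
    negate : ∀ y k D → - (y + k * D) ≡ - y + (- k) * D
    negate = solve-∀
    move : ∀ L R Q K → L + Q ≡ R + (Q + K) → L ≡ R + K
    move = λ L R Q K h → trans (sym (cancel L Q)) (trans (cong (_- Q) h) (cancel′ R Q K))
      where
      cancel : ∀ L Q → (L + Q) - Q ≡ L
      cancel = solve-∀
      cancel′ : ∀ R Q K → (R + (Q + K)) - Q ≡ R + K
      cancel′ = solve-∀
    pos-lin : ∀ y k → + (y ℕ.+ k ℕ.* d) ≡ + y + + k * D
    pos-lin y k = trans (ℤP.pos-+ y (k ℕ.* d)) (cong (λ t → + y + t) (ℤP.pos-* k d))

  ≈-refl : ∀ {x} → x ≈ x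
  ≈-refl {x} = ≈-by (+ 0) (plus-zero x D)

  ≡⇒≈ : ∀ {x y} → x ≡ y → x ≈ y
  ≡⇒≈ refl = ≈-refl

  ≈-sym : ∀ {x y} → x ≈ y → y ≈ x
  ≈-sym {y = y} (≈-by k refl) = ≈-by (- k) (undo y k D)

  ≈-trans : ∀ {x y z} → x ≈ y → y ≈ z → x ≈ z
  ≈-trans {z = z} (≈-by k refl) (≈-by k′ refl) = ≈-by (k + k′) (collect z k k′ D)

  ≈-setoid : Setoid _ _
  ≈-setoid = record
    { Carrier = ℤ ; _≈_ = _≈_
    ; isEquivalence = record { refl = ≈-refl ; sym = ≈-sym ; trans = ≈-trans } }

  module ≈-Reasoning = Relation.Binary.Reasoning.Setoid ≈-setoid

  ≈-+ : ∀ {x y x′ y′} → x ≈ x′ → y ≈ y′ → x + y ≈ x′ + y′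
  ≈-+ {x′ = x′} {y′} (≈-by k refl) (≈-by k′ refl) = ≈-by (k + k′) (add x′ y′ k k′ D)

  ≈-* : ∀ c {x y} → x ≈ y → c * x ≈ c * y
  ≈-* c {y = y} (≈-by k refl) = ≈-by (c * k) (scale c y k D)

  ≈-neg : ∀ {x y} → x ≈ y → - x ≈ - y
  ≈-neg {y = y} (≈-by k refl) = ≈-by (- k) (negate y k D)

  multiple≈0 : ∀ k → k * D ≈ + 0
  multiple≈0 k = ≈-by k (sym (ℤP.+-identityˡ (k * D)))

  ≈-shift : ∀ {L R P Q} → P ≈ Q → L + Q ≡ R + P → L ≈ R
  ≈-shift {L} {R} {Q = Q} (≈-by k refl) h = ≈-by k (move L R Q (k * D) h)

  ≈⇒% : ∀ {x y : ℕ} → + x ≈ + y → x ℕ.% d ≡ y ℕ.% d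
  ≈⇒% {x} {y} (≈-by (+ k) eq) = begin
      x ℕ.% d               ≡⟨ cong (ℕ._% d) (ℤP.+-injective (trans eq (sym (pos-lin y k)))) ⟩
      (y ℕ.+ k ℕ.* d) ℕ.% d ≡⟨ [m+kn]%n≡m%n y k d ⟩
      y ℕ.% d               ∎
    where open ≡-Reasoning
  ≈⇒% {x} {y} (≈-by -[1+ k ] eq) = sym (begin
      y ℕ.% d                   ≡⟨ cong (ℕ._% d) (ℤP.+-injective (trans eq′ (sym (pos-lin x (suc k))))) ⟩
      (x ℕ.+ suc k ℕ.* d) ℕ.% d ≡⟨ [m+kn]%n≡m%n x (suc k) d ⟩
      x ℕ.% d                   ∎)
    where
    open ≡-Reasoning
    eq′ : + y ≡ + x + (+ suc k) * D
    eq′ = trans (undo (+ y) -[1+ k ] D) (cong (_+ (+ suc k) * D) (sym eq))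

  %⇒≈ : ∀ {x y : ℕ} → x ℕ.% d ≡ y ℕ.% d → + x ≈ + y
  %⇒≈ {x} {y} eq = ≈-trans (reduce x) (≈-trans (≡⇒≈ (cong +_ eq)) (≈-sym (reduce y)))
    where
    reduce : ∀ z → + z ≈ + (z ℕ.% d)
    reduce z = ≈-by (+ (z ℕ./ d)) (trans (cong +_ (m≡m%n+[m/n]*n z d)) (pos-lin (z ℕ.% d) (z ℕ./ d)))


sign : Bool → ℤ
sign false = + 1
sign true  = -[1+ 0 ]

sign-not : ∀ b → sign (not b) ≡ - sign b
sign-not false = refl
sign-not true  = refl

parity : ℕ → Bool
parity zero    = false
parity (suc k) = not (parity k)

bit : Bool → ℕ
bit false = 0
bit true  = 1

parity-%2 : ∀ k → k ℕ.% 2 ≡ bit (parity k)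
parity-%2 zero          = refl
parity-%2 (suc zero)    = refl
parity-%2 (suc (suc k)) = begin
  (2 ℕ.+ k) ℕ.% 2                 ≡⟨ cong (ℕ._% 2) (ℕP.+-comm 2 k) ⟩
  (k ℕ.+ 2) ℕ.% 2                 ≡⟨ [m+n]%n≡m%n k 2 ⟩
  k ℕ.% 2                         ≡⟨ parity-%2 k ⟩
  bit (parity k)                  ≡⟨ cong bit (sym (not-involutive (parity k))) ⟩
  bit (not (not (parity k)))      ∎
  where open ≡-Reasoning

parity-even : ∀ k → k ℕ.% 2 ≡ 0 → parity k ≡ false
parity-even k k-even with parity k | parity-%2 k
... | false | _     = refl
... | true  | k%2≡1 with () ← trans (sym k%2≡1) k-even

%2-cases : ∀ k → k ℕ.% 2 ≡ 1 ⊎ k ℕ.% 2 ≡ 0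
%2-cases k with parity k | parity-%2 k
... | true  | k%2≡1 = inj₁ k%2≡1
... | false | k%2≡0 = inj₂ k%2≡0

alt : ∀ {d} → List (Fin d) → ℤ
alt []       = + 0
alt (l ∷ ls) = + toℕ l - alt ls

alt-split : ∀ {d} (ls : List (Fin d)) → alt ls ≡ + oddSum ls - + evenSum ls
alt-split []       = refl
alt-split (l ∷ ls) = begin
    + toℕ l - alt ls                          ≡⟨ cong (λ t → + toℕ l - t) (alt-split ls) ⟩
    + toℕ l - (+ oddSum ls - + evenSum ls)    ≡⟨ regroup (+ toℕ l) (+ oddSum ls) (+ evenSum ls) ⟩
    (+ toℕ l + + evenSum ls) - + oddSum ls    ≡⟨ cong (λ t → t - + oddSum ls) (sym (ℤP.pos-+ (toℕ l) (evenSum ls))) ⟩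
    + (toℕ l ℕ.+ evenSum ls) - + oddSum ls    ∎
  where
  open ≡-Reasoning
  regroup : ∀ a b c → a - (b - c) ≡ (a + c) - b
  regroup = solve-∀

labelSum-split : ∀ {d} (ls : List (Fin d)) → labelSum ls ≡ oddSum ls ℕ.+ evenSum ls
labelSum-split []       = refl
labelSum-split (l ∷ ls) = begin
  toℕ l ℕ.+ labelSum ls                     ≡⟨ cong (toℕ l ℕ.+_) (labelSum-split ls) ⟩
  toℕ l ℕ.+ (oddSum ls ℕ.+ evenSum ls)      ≡⟨ cong (toℕ l ℕ.+_) (ℕP.+-comm (oddSum ls) (evenSum ls)) ⟩
  toℕ l ℕ.+ (evenSum ls ℕ.+ oddSum ls)      ≡⟨ ℕP.+-assoc (toℕ l) (evenSum ls) (oddSum ls) ⟨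
  toℕ l ℕ.+ evenSum ls ℕ.+ oddSum ls        ∎
  where open ≡-Reasoning

module LabelledWalks {d : ℕ} (G : Graph) (f : Fin (Graph.m G) → Maybe (Fin d)) where
  open Graph G

  Joins-sym : ∀ {e u w} → Joins G e u w → Joins G e w u
  Joins-sym (inj₁ p) = inj₂ p
  Joins-sym (inj₂ p) = inj₁ p

  data HWalk : Fin n → Fin n → Set where
    done : ∀ {v} → HWalk v v
    via  : ∀ {u w x} (e : Fin m) (l : Fin d) → f e ≡ just l → Joins G e u w → HWalk w x → HWalk u x

  edgesOf : ∀ {u x} → HWalk u x → List (Fin m)
  edgesOf done              = []
  edgesOf (via e _ _ _ W)   = e ∷ edgesOf W

  labelsOf : ∀ {u x} → HWalk u x → List (Fin d)
  labelsOf done             = []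
  labelsOf (via _ l _ _ W)  = l ∷ labelsOf W

  asWalk : ∀ {u x} (W : HWalk u x) → Walk G u x (edgesOf W)
  asWalk done              = nil
  asWalk (via _ _ _ j W)   = cons j (asWalk W)

  asLabelled : ∀ {u x} (W : HWalk u x) → Pointwise (λ e l → f e ≡ just l) (edgesOf W) (labelsOf W)
  asLabelled done             = []
  asLabelled (via _ _ fe _ W) = fe ∷ asLabelled W

  par : ∀ {u x} → HWalk u x → Bool
  par done             = false
  par (via _ _ _ _ W)  = not (par W)

  par-length : ∀ {u x} (W : HWalk u x) → parity (length (edgesOf W)) ≡ par W
  par-length done            = refl
  par-length (via _ _ _ _ W) = cong not (par-length W)

  altʷ : ∀ {u x} → HWalk u x → ℤ
  altʷ W = alt (labelsOf W)

  infixr 5 _++ʷ_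
  _++ʷ_ : ∀ {u w x} → HWalk u w → HWalk w x → HWalk u x
  done ++ʷ Q            = Q
  via e l fe j P ++ʷ Q  = via e l fe j (P ++ʷ Q)

  par-++ : ∀ {u w x} (P : HWalk u w) (Q : HWalk w x) → par (P ++ʷ Q) ≡ par P xor par Q
  par-++ done Q            = refl
  par-++ (via _ _ _ _ P) Q = trans (cong not (par-++ P Q)) (not-distribˡ-xor (par P) (par Q))

  alt-++ : ∀ {u w x} (P : HWalk u w) (Q : HWalk w x) → altʷ (P ++ʷ Q) ≡ altʷ P + sign (par P) * altʷ Q
  alt-++ done Q = sym (trans (ℤP.+-identityˡ _) (ℤP.*-identityˡ _))
  alt-++ (via e l fe j P) Q = begin
      + toℕ l - altʷ (P ++ʷ Q)                                ≡⟨ cong (λ t → + toℕ l - t) (alt-++ P Q) ⟩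
      + toℕ l - (altʷ P + sign (par P) * altʷ Q)              ≡⟨ regroup (+ toℕ l) (altʷ P) (sign (par P)) (altʷ Q) ⟩
      (+ toℕ l - altʷ P) + (- sign (par P)) * altʷ Q          ≡⟨ cong (λ s → (+ toℕ l - altʷ P) + s * altʷ Q) (sign-not (par P)) ⟨
      (+ toℕ l - altʷ P) + sign (not (par P)) * altʷ Q        ∎
    where
    open ≡-Reasoning
    regroup : ∀ a b c e → a - (b + c * e) ≡ (a - b) + (- c) * e
    regroup = solve-∀

  reverseʷ : ∀ {u x} → HWalk u x → HWalk x u
  reverseʷ done              = done
  reverseʷ (via e l fe j W)  = reverseʷ W ++ʷ via e l fe (Joins-sym j) done

  par-reverse : ∀ {u x} (W : HWalk u x) → par (reverseʷ W) ≡ par W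
  par-reverse done = refl
  par-reverse (via e l fe j W) = begin
    par (reverseʷ W ++ʷ via e l fe (Joins-sym j) done)  ≡⟨ par-++ (reverseʷ W) _ ⟩
    par (reverseʷ W) xor true                           ≡⟨ cong (_xor true) (par-reverse W) ⟩
    par W xor true                                      ≡⟨ xor-true (par W) ⟩
    not (par W)                                         ∎
    where
    open ≡-Reasoning
    xor-true : ∀ a → a xor true ≡ not a
    xor-true false = refl
    xor-true true  = refl

  alt-reverse : ∀ {u x} (W : HWalk u x) → altʷ (reverseʷ W) ≡ - (sign (par W) * altʷ W)
  alt-reverse done = refl
  alt-reverse (via e l fe j W) = begin
      altʷ (reverseʷ W ++ʷ via e l fe (Joins-sym j) done)          ≡⟨ alt-++ (reverseʷ W) _ ⟩
      altʷ (reverseʷ W) + sign (par (reverseʷ W)) * (+ toℕ l - + 0) ≡⟨ cong₂ (λ a b → a + sign b * (+ toℕ l - + 0)) (alt-reverse W) (par-reverse W) ⟩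
      - (sign (par W) * altʷ W) + sign (par W) * (+ toℕ l - + 0)    ≡⟨ regroup (sign (par W)) (altʷ W) (+ toℕ l) ⟩
      - ((- sign (par W)) * (+ toℕ l - altʷ W))                     ≡⟨ cong (λ s → - (s * (+ toℕ l - altʷ W))) (sign-not (par W)) ⟨
      - (sign (not (par W)) * (+ toℕ l - altʷ W))                   ∎
    where
    open ≡-Reasoning
    regroup : ∀ s a l → - (s * a) + s * (l - + 0) ≡ - ((- s) * (l - a))
    regroup = solve-∀

Known : ∀ {A : Set} → Maybe A → Set
Known m = is-just m ≡ true

<∣>-knownˡ : ∀ {A : Set} (a b : Maybe A) → Known a → Known (a <∣> b)
<∣>-knownˡ (just _) b _ = refl

<∣>-knownʳ : ∀ {A : Set} (a b : Maybe A) → Known b → Known (a <∣> b)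
<∣>-knownʳ (just _) b _     = refl
<∣>-knownʳ nothing  b known = known

map-known : ∀ {A B : Set} (g : A → B) (m : Maybe A) → Known m → Known (Maybe.map g m)
map-known g (just _) _ = refl

extract : ∀ {A : Set} (m : Maybe A) → Known m → A
extract (just a) _ = a

firstJust : ∀ {A B : Set} → (A → Maybe B) → List A → Maybe B
firstJust g []       = nothing
firstJust g (a ∷ as) = g a <∣> firstJust g as

firstJust-known : ∀ {A B : Set} (g : A → Maybe B) {a as} → a ∈ as → Known (g a) → Known (firstJust g as)
firstJust-known g {as = a′ ∷ as} (here refl) known = <∣>-knownˡ (g a′) _ known
firstJust-known g {as = a′ ∷ as} (there a∈) known = <∣>-knownʳ (g a′) _ (firstJust-known g a∈ known)

-- The least index at which a Boolean predicate on Fin k holds; it depends only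
-- on the predicate's values, which makes it a canonical choice.
firstTrue : ∀ {k} → (Fin k → Bool) → Maybe (Fin k)
firstTrue {zero}  g = nothing
firstTrue {suc k} g = if g Fin.zero then just Fin.zero else Maybe.map Fin.suc (firstTrue (g ∘ Fin.suc))

firstTrue-cong : ∀ {k} (g h : Fin k → Bool) → (∀ i → g i ≡ h i) → firstTrue g ≡ firstTrue h
firstTrue-cong {zero}  g h g≗h = refl
firstTrue-cong {suc k} g h g≗h
  rewrite g≗h Fin.zero | firstTrue-cong (g ∘ Fin.suc) (h ∘ Fin.suc) (g≗h ∘ Fin.suc) = refl

firstTrue-found : ∀ {k} (g : Fin k → Bool) y → g y ≡ true → Σ (Fin k) λ z → firstTrue g ≡ just z × g z ≡ true
firstTrue-found {suc k} g y gy with g Fin.zero in g0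
... | true  = Fin.zero , refl , g0
... | false = later y gy
  where
  later : ∀ y → g y ≡ true → Σ (Fin (suc k)) λ z → Maybe.map Fin.suc (firstTrue (g ∘ Fin.suc)) ≡ just z × g z ≡ true
  later Fin.zero    gy′ with () ← trans (sym g0) gy′
  later (Fin.suc y) gy′ with firstTrue-found (g ∘ Fin.suc) y gy′
  ... | z , first , gz = Fin.suc z , cong (Maybe.map Fin.suc) first , gz

module Saturation {I : Set} (W : I → Set) (enum : List I) (enum-complete : ∀ i → i ∈ enum)
                  (grow : ((i : I) → Maybe (W i)) → (i : I) → Maybe (W i)) where

  Section : Set
  Section = (i : I) → Maybe (W i)

  _⊑_ : Section → Section → Set
  M ⊑ M′ = ∀ i → Known (M i) → Known (M′ i)

  step : Section → Section
  step M i = M i <∣> grow M i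

  step-extends : ∀ M → M ⊑ step M
  step-extends M i = <∣>-knownˡ (M i) (grow M i)

  ClosedAt : Section → I → Set
  ClosedAt M i = Known (grow M i) → Known (M i)

  Closed : Section → Set
  Closed M = ∀ i → ClosedAt M i

  closedAt? : ∀ M i → Dec (ClosedAt M i)
  closedAt? M i = (is-just (grow M i) ≟ᵇ true) →-dec (is-just (M i) ≟ᵇ true)

  closed? : ∀ M → Dec (All (ClosedAt M) enum)
  closed? M = all? (closedAt? M) enum

  count : List I → Section → ℕ
  count []       M = 0
  count (i ∷ is) M = bit (is-just (M i)) ℕ.+ count is M

  Gain : Section → Section → I → Set
  Gain M M′ i = is-just (M i) ≡ false × Known (M′ i)

  private
    bit-mono : ∀ {a b} → (a ≡ true → b ≡ true) → bit a ≤ bit b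
    bit-mono {false}          _ = z≤n
    bit-mono {true} {b} a⇒b rewrite a⇒b refl = ℕP.≤-refl

    bit≤1 : ∀ a → bit a ≤ 1
    bit≤1 false = z≤n
    bit≤1 true  = s≤s z≤n

  count≤length : ∀ xs M → count xs M ≤ length xs
  count≤length []       M = z≤n
  count≤length (i ∷ xs) M = ℕP.+-mono-≤ (bit≤1 (is-just (M i))) (count≤length xs M)

  count-mono : ∀ {M M′} xs → M ⊑ M′ → count xs M ≤ count xs M′
  count-mono []       M⊑M′ = z≤n
  count-mono (i ∷ xs) M⊑M′ = ℕP.+-mono-≤ (bit-mono (M⊑M′ i)) (count-mono xs M⊑M′)

  count-strict : ∀ {M M′ xs} → M ⊑ M′ → Any (Gain M M′) xs → count xs M < count xs M′
  count-strict {M} {M′} {i ∷ xs} M⊑M′ (here (unknown , known))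
    rewrite unknown | known = s≤s (count-mono xs M⊑M′)
  count-strict {M} {M′} {i ∷ xs} M⊑M′ (there gain) =
    ℕP.+-mono-≤-< (bit-mono (M⊑M′ i)) (count-strict M⊑M′ gain)

  unclosed⇒gain : ∀ M i → ¬ ClosedAt M i → Gain M (step M) i
  unclosed⇒gain M i not-closed with M i | not-closed
  ... | just _  | not-closed′ = contradiction (λ _ → refl) not-closed′
  ... | nothing | not-closed′ with grow M i
  ...   | just _  = refl , refl
  ...   | nothing = contradiction (λ ()) not-closed′

  saturate : ℕ → Section → Section
  saturate zero    M = M
  saturate (suc k) M with closed? M
  ... | yes _ = M
  ... | no  _ = saturate k (step M)

  saturate-extends : ∀ k M → M ⊑ saturate k M
  saturate-extends zero    M i known = known
  saturate-extends (suc k) M i known with closed? M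
  ... | yes _ = known
  ... | no  _ = saturate-extends k (step M) i (step-extends M i known)

  -- each unclosed round strictly increases the count
  saturate-progress : ∀ k M → Closed (saturate k M) ⊎ count enum M ℕ.+ k ≤ count enum (saturate k M)
  saturate-progress zero    M = inj₂ (ℕP.≤-reflexive (ℕP.+-identityʳ _))
  saturate-progress (suc k) M with closed? M
  ... | yes closed = inj₁ (λ i → All.lookup closed (enum-complete i))
  ... | no  not-closed with saturate-progress k (step M)
  ...   | inj₁ closed = inj₁ closed
  ...   | inj₂ grown  = inj₂ (begin
      count enum M ℕ.+ suc k          ≡⟨ ℕP.+-suc (count enum M) k ⟩
      suc (count enum M) ℕ.+ k        ≤⟨ ℕP.+-monoˡ-≤ k (count-strict (step-extends M) gains) ⟩
      count enum (step M) ℕ.+ k       ≤⟨ grown ⟩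
      count enum (saturate k (step M)) ∎)
    where
    open ℕP.≤-Reasoning
    gains : Any (Gain M (step M)) enum
    gains = Any.map (unclosed⇒gain M _) (¬All⇒Any¬ (closedAt? M) enum not-closed)

  saturation : Section → Section
  saturation = saturate (suc (length enum))

  saturation-extends : ∀ M → M ⊑ saturation M
  saturation-extends = saturate-extends (suc (length enum))

  saturation-closed : ∀ M → Closed (saturation M)
  saturation-closed M with saturate-progress (suc (length enum)) M
  ... | inj₁ closed = closed
  ... | inj₂ grown  = contradiction (ℕP.≤-trans grown′ (count≤length enum _)) (ℕP.n≮n (length enum))
    where
    grown′ : suc (length enum) ≤ count enum (saturation M)
    grown′ = ℕP.≤-trans (ℕP.m≤n+m _ (count enum M)) grown

-- Reachability with parity in H: for a target x, the saturation of the
-- one-edge extension step finds, for every vertex y and parity p, an H-walk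
-- from y to x of parity p whenever one exists.
module ParityReach {d : ℕ} (G : Graph) (f : Fin (Graph.m G) → Maybe (Fin d)) (x : Fin (Graph.n G)) where
  open Graph G
  open LabelledWalks G f

  Route : Fin n × Bool → Set
  Route (y , p) = Σ (HWalk y x) λ W → par W ≡ p

  prepend : ∀ {e l y z p} → f e ≡ just l → Joins G e y z → Route (z , not p) → Route (y , p)
  prepend {e} {l} {p = p} fe j (W , parW) = via e l fe j W , trans (cong not parW) (not-involutive p)

  positions : List (Fin n × Bool)
  positions = cartesianProduct (allFin n) (false ∷ true ∷ [])

  positions-complete : ∀ yp → yp ∈ positions
  positions-complete (y , p) = ∈-cartesianProduct⁺ (∈-allFin y) (bool∈ p)
    where
    bool∈ : ∀ b → b ∈ false ∷ true ∷ []
    bool∈ false = here refl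
    bool∈ true  = there (here refl)

  Partial : Set
  Partial = (yp : Fin n × Bool) → Maybe (Route yp)

  private
    fromEnd : (M : Partial) → ∀ {y p e l} → f e ≡ just l → (a b : Fin n) → (a ≡ y → Joins G e y b) →
              Dec (a ≡ y) → Maybe (Route (y , p))
    fromEnd M {p = p} fe a b join (yes a≡y) = Maybe.map (prepend fe (join a≡y)) (M (b , not p))
    fromEnd M         fe a b join (no _)    = nothing

    fromEnd-known : (M : Partial) → ∀ {y p e l} (fe : f e ≡ just l) (a b : Fin n) (join : a ≡ y → Joins G e y b)
                    (a≟y : Dec (a ≡ y)) → a ≡ y → Known (M (b , not p)) → Known (fromEnd M {p = p} fe a b join a≟y)
    fromEnd-known M {p = p} fe a b join (yes a≡y) _   known = map-known (prepend fe (join a≡y)) (M (b , not p)) known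
    fromEnd-known M         fe a b join (no a≢y)  a≡y _     = contradiction a≡y a≢y

    -- extend along e at whichever end is y; the label is matched through the
    -- equation f e ≡ ml so that the new route can record f e ≡ just l
    fromEdge : (M : Partial) → ∀ y p e {ml} → f e ≡ ml → Maybe (Route (y , p))
    fromEdge M y p e {nothing} _  = nothing
    fromEdge M y p e {just l}  fe =
      fromEnd M fe (src e) (tgt e) (λ s → inj₁ (s , refl)) (src e Fin.≟ y) <∣>
      fromEnd M fe (tgt e) (src e) (λ t → inj₂ (refl , t)) (tgt e Fin.≟ y)

    fromEdge-known : (M : Partial) → ∀ {y z p e l} {ml} (fe : f e ≡ ml) → ml ≡ just l → Joins G e y z →
                     Known (M (z , not p)) → Known (fromEdge M y p e fe)
    fromEdge-known M {y} {p = p} {e} fe refl (inj₁ (s , t)) known =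
      <∣>-knownˡ (fromEnd M fe (src e) (tgt e) _ (src e Fin.≟ y)) _
        (fromEnd-known M fe (src e) (tgt e) _ (src e Fin.≟ y) s (subst (λ z → Known (M (z , not p))) (sym t) known))
    fromEdge-known M {y} {p = p} {e} fe refl (inj₂ (s , t)) known =
      <∣>-knownʳ (fromEnd M fe (src e) (tgt e) _ (src e Fin.≟ y)) _
        (fromEnd-known M fe (tgt e) (src e) _ (tgt e Fin.≟ y) t (subst (λ z → Known (M (z , not p))) (sym s) known))

  grow : Partial → Partial
  grow M (y , p) = firstJust (λ e → fromEdge M y p e refl) (allFin m)

  grow-known : ∀ M {e l y z p} → f e ≡ just l → Joins G e y z → Known (M (z , not p)) → Known (grow M (y , p))
  grow-known M {e} {y = y} {p = p} fe j known =
    firstJust-known (λ e → fromEdge M y p e refl) (∈-allFin e) (fromEdge-known M refl fe j known)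

  start : Partial
  start (y , true)  = nothing
  start (y , false) with y Fin.≟ x
  ... | yes refl = just (done , refl)
  ... | no _     = nothing

  start-known : Known (start (x , false))
  start-known with x Fin.≟ x
  ... | yes refl = refl
  ... | no x≢x   = contradiction refl x≢x

  open Saturation Route positions positions-complete grow

  reach : Partial
  reach = saturation start

  reach-complete : ∀ {y} (W : HWalk y x) → Known (reach (y , par W))
  reach-complete done = saturation-extends start (x , false) start-known
  reach-complete (via e l fe j W) = saturation-closed start _
    (grow-known reach fe j (subst (λ p → Known (reach (_ , p))) (sym (not-involutive (par W))) (reach-complete W)))

-- Components of H: every vertex x gets a canonical root, the least vertex
-- linked to x by an H-walk, together with an H-walk from the root to x;
-- both ends of a labelled edge get the same root.
module Components {d : ℕ} (G : Graph) (f : Fin (Graph.m G) → Maybe (Fin d)) where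
  open Graph G
  open LabelledWalks G f
  open ParityReach G f using (reach; reach-complete)

  route : ∀ x y → Maybe (HWalk y x)
  route x y = Maybe.map proj₁ (reach x (y , false)) <∣> Maybe.map proj₁ (reach x (y , true))

  route-complete : ∀ {x y} → HWalk y x → Known (route x y)
  route-complete {x} {y} W with par W in parW
  ... | false = <∣>-knownˡ (Maybe.map proj₁ (reach x (y , false))) _
                  (map-known proj₁ (reach x (y , false)) (subst (λ p → Known (reach x (y , p))) parW (reach-complete x W)))
  ... | true  = <∣>-knownʳ (Maybe.map proj₁ (reach x (y , false))) _
                  (map-known proj₁ (reach x (y , true)) (subst (λ p → Known (reach x (y , p))) parW (reach-complete x W)))

  linked : Fin n → Fin n → Bool
  linked x y = is-just (route x y)

  private
    rootOf : ∀ x → Σ (Fin n) λ z → firstTrue (linked x) ≡ just z × linked x z ≡ true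
    rootOf x = firstTrue-found (linked x) x (route-complete done)

  root : Fin n → Fin n
  root x = proj₁ (rootOf x)

  rootWalk : ∀ x → HWalk (root x) x
  rootWalk x = extract (route x (root x)) (proj₂ (proj₂ (rootOf x)))

  linked-edge : ∀ {e l u w} → f e ≡ just l → Joins G e u w → ∀ y → linked u y ≡ true → linked w y ≡ true
  linked-edge {e} {l} {u} {w} fe j y linked-uy =
    route-complete (extract (route u y) linked-uy ++ʷ via e l fe j done)

  root-edge : ∀ {e l u w} → f e ≡ just l → Joins G e u w → root u ≡ root w
  root-edge {u = u} {w} fe j = just-injective (begin
      just (root u)         ≡⟨ proj₁ (proj₂ (rootOf u)) ⟨
      firstTrue (linked u)  ≡⟨ firstTrue-cong (linked u) (linked w) same ⟩
      firstTrue (linked w)  ≡⟨ proj₁ (proj₂ (rootOf w)) ⟩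
      just (root w)         ∎)
    where
    open ≡-Reasoning
    bool-ext : ∀ {a b} → (a ≡ true → b ≡ true) → (b ≡ true → a ≡ true) → a ≡ b
    bool-ext {false} {false} _ _   = refl
    bool-ext {false} {true}  _ b⇒a = b⇒a refl
    bool-ext {true}          a⇒b _ = sym (a⇒b refl)
    same : ∀ y → linked u y ≡ linked w y
    same y = bool-ext (linked-edge fe j y) (linked-edge fe (Joins-sym j) y)

IsPotential : (d : ℕ) .{{_ : NonZero d}} (G : Graph) → (Fin (Graph.m G) → Maybe (Fin d)) → (Fin (Graph.n G) → ℤ) → Set
IsPotential d G f π = ∀ e l → f e ≡ just l → Congruence._≈_ d (+ toℕ l) (π (Graph.src G e) + π (Graph.tgt G e))

module PotentialConstruction (d : ℕ) .{{_ : NonZero d}} (G : Graph) (f : Fin (Graph.m G) → Maybe (Fin d)) where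
  open Graph G
  open LabelledWalks G f
  open Congruence d
  open Components G f
  open ParityReach G f using (Route; reach; reach-complete)

  even-closed : EvenCycleProperty G d f → ∀ {v} (C : HWalk v v) → par C ≡ false → altʷ C ≈ + 0
  even-closed ecp done _ = ≈-refl
  even-closed ecp {v} C@(via _ _ _ _ _) even = begin
      altʷ C                                                  ≡⟨ alt-split (labelsOf C) ⟩
      + oddSum (labelsOf C) - + evenSum (labelsOf C)          ≈⟨ ≈-+ balanced (≈-refl {x = - + evenSum (labelsOf C)}) ⟩
      + evenSum (labelsOf C) - + evenSum (labelsOf C)         ≡⟨ ℤP.+-inverseʳ (+ evenSum (labelsOf C)) ⟩
      + 0                                                     ∎
    where
    open ≈-Reasoning
    len : length (edgesOf C) ℕ.% 2 ≡ 0
    len = trans (parity-%2 (length (edgesOf C))) (cong bit (trans (par-length C) even))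
    balanced : + oddSum (labelsOf C) ≈ + evenSum (labelsOf C)
    balanced = %⇒≈ (ecp v (edgesOf C) (labelsOf C) (asWalk C) (s≤s z≤n) len (asLabelled C))

  Halvable : Set
  Halvable = ∀ {v} (C : HWalk v v) → par C ≡ true → Σ ℤ λ t → t + t ≈ altʷ C

  private
    half : ℕ
    half = d ℕ./ 2

    d-split : d ≡ d ℕ.% 2 ℕ.+ half ℕ.* 2
    d-split = m≡m%n+[m/n]*n d 2

  -- for odd d = 2q + 1, the number 2 is invertible: 2·(q + 1)·a ≡ a
  halvable-odd : d ℕ.% 2 ≡ 1 → Halvable
  halvable-odd d-odd C _ = t , ≈-by (altʷ C) twice
    where
    t : ℤ
    t = altʷ C * + suc half
    D≡ : D ≡ + 1 + + half * + 2
    D≡ = trans (cong +_ (trans d-split (cong (ℕ._+ half ℕ.* 2) d-odd)))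
               (trans (ℤP.pos-+ 1 (half ℕ.* 2)) (cong (λ s → + 1 + s) (ℤP.pos-* half 2)))
    expand : ∀ a q → a * (+ 1 + q) + a * (+ 1 + q) ≡ a + a * (+ 1 + q * + 2)
    expand = solve-∀
    twice : t + t ≡ altʷ C + altʷ C * D
    twice = begin
      t + t                                             ≡⟨ cong (λ s → altʷ C * s + altʷ C * s) (ℤP.pos-+ 1 half) ⟩
      altʷ C * (+ 1 + + half) + altʷ C * (+ 1 + + half) ≡⟨ expand (altʷ C) (+ half) ⟩
      altʷ C + altʷ C * (+ 1 + + half * + 2)            ≡⟨ cong (λ s → altʷ C + altʷ C * s) D≡ ⟨
      altʷ C + altʷ C * D                               ∎
      where open ≡-Reasoning

  -- for even d = 2q, the odd cycle property makes the label sum L of an odd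
  -- closed walk even: 2q ∣ q·L gives L = 2c, and then
  -- alt = L − 2·(even-position sum) = 2·(c − even-position sum)
  halvable-even : d ℕ.% 2 ≡ 0 → OddCycleProperty G d f → Halvable
  halvable-even d-even ocp {v} C odd = + c - + evenSum ls , ≡⇒≈ twice
    where
    ls : List (Fin d)
    ls = labelsOf C
    d≡2q : d ≡ half ℕ.* 2
    d≡2q = trans d-split (cong (ℕ._+ half ℕ.* 2) d-even)
    instance
      half-nonzero : NonZero half
      half-nonzero = ℕ.≢-nonZero λ q≡0 → ℕ.≢-nonZero⁻¹ d (trans d≡2q (cong (ℕ._* 2) q≡0))
    len : length (edgesOf C) ℕ.% 2 ≡ 1
    len = trans (parity-%2 (length (edgesOf C))) (cong bit (trans (par-length C) odd))
    2∣L : 2 ∣ labelSum ls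
    2∣L = *-cancelˡ-∣ half (subst (_∣ half ℕ.* labelSum ls) d≡2q
            (m%n≡0⇒n∣m (half ℕ.* labelSum ls) d (ocp v (edgesOf C) ls (asWalk C) len (asLabelled C))))
    c : ℕ
    c = _∣_.quotient 2∣L
    sum≡2c : + oddSum ls + + evenSum ls ≡ + c * + 2
    sum≡2c = begin
      + oddSum ls + + evenSum ls     ≡⟨ ℤP.pos-+ (oddSum ls) (evenSum ls) ⟨
      + (oddSum ls ℕ.+ evenSum ls)   ≡⟨ cong +_ (labelSum-split ls) ⟨
      + labelSum ls                  ≡⟨ cong +_ (_∣_.equality 2∣L) ⟩
      + (c ℕ.* 2)                    ≡⟨ ℤP.pos-* c 2 ⟩
      + c * + 2                      ∎
      where open ≡-Reasoning
    double : ∀ c e → (c - e) + (c - e) ≡ c * + 2 - e - e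
    double = solve-∀
    cancel : ∀ o e → (o + e) - e - e ≡ o - e
    cancel = solve-∀
    twice : (+ c - + evenSum ls) + (+ c - + evenSum ls) ≡ altʷ C
    twice = begin
      (+ c - + evenSum ls) + (+ c - + evenSum ls)            ≡⟨ double (+ c) (+ evenSum ls) ⟩
      + c * + 2 - + evenSum ls - + evenSum ls                ≡⟨ cong (λ s → s - + evenSum ls - + evenSum ls) sum≡2c ⟨
      (+ oddSum ls + + evenSum ls) - + evenSum ls - + evenSum ls ≡⟨ cancel (+ oddSum ls) (+ evenSum ls) ⟩
      + oddSum ls - + evenSum ls                             ≡⟨ alt-split ls ⟨
      altʷ C                                                 ∎
      where open ≡-Reasoning

  even-cycle-property : Compatible G d f → EvenCycleProperty G d f
  even-cycle-property (inj₁ (_ , ecp))     = ecp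
  even-cycle-property (inj₂ (_ , ecp , _)) = ecp

  halvable : Compatible G d f → Halvable
  halvable (inj₁ (d-odd , _))        = halvable-odd d-odd
  halvable (inj₂ (d-even , _ , ocp)) = halvable-even d-even ocp

  -- the potential identity at an edge uw, given root walks a, b to its ends:
  -- the closed walk (root → u) · e · (w → root) has parity pu xor not pw and
  -- alternating sum a + (−1)^pu (l + (−1)^pw b), which is ≡ 0 when even and ≡ 2T when odd
  edge-identity : ∀ pu pw T a b l →
                  (pu xor not pw ≡ false → a + sign pu * (l - - (sign pw * b)) ≈ + 0) →
                  (pu xor not pw ≡ true → T + T ≈ a + sign pu * (l - - (sign pw * b))) →
                  l ≈ sign pu * (T - a) + sign pw * (T - b)
  edge-identity false false T a b l _ odd  = ≈-shift (≈-sym (odd refl)) (identity-ff T a b l)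
    where
    identity-ff : ∀ T a b l → l + (T + T) ≡ (+ 1 * (T - a) + + 1 * (T - b)) + (a + + 1 * (l - - (+ 1 * b)))
    identity-ff = solve-∀
  edge-identity false true  T a b l even _ = ≈-shift (even refl) (identity-ft T a b l)
    where
    identity-ft : ∀ T a b l → l + + 0 ≡ (+ 1 * (T - a) + -[1+ 0 ] * (T - b)) + (a + + 1 * (l - - (-[1+ 0 ] * b)))
    identity-ft = solve-∀
  edge-identity true  false T a b l even _ = ≈-shift (≈-sym (even refl)) (identity-tf T a b l)
    where
    identity-tf : ∀ T a b l → l + (a + -[1+ 0 ] * (l - - (+ 1 * b))) ≡ (-[1+ 0 ] * (T - a) + + 1 * (T - b)) + + 0
    identity-tf = solve-∀
  edge-identity true  true  T a b l _ odd  = ≈-shift (odd refl) (identity-tt T a b l)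
    where
    identity-tt : ∀ T a b l → l + (a + -[1+ 0 ] * (l - - (-[1+ 0 ] * b))) ≡ (-[1+ 0 ] * (T - a) + -[1+ 0 ] * (T - b)) + (T + T)
    identity-tt = solve-∀

  module _ (ecp : EvenCycleProperty G d f) (halve : Halvable) where

    -- all odd closed walks at a vertex have congruent alternating sums, as
    -- C₀ followed by C reversed is an even closed walk
    odd-closed-agree : ∀ {ρ} (C₀ C : HWalk ρ ρ) → par C₀ ≡ true → par C ≡ true → altʷ C₀ ≈ altʷ C
    odd-closed-agree C₀ C odd₀ odd = ≈-shift (even-closed ecp (C₀ ++ʷ reverseʷ C) even) identity
      where
      even : par (C₀ ++ʷ reverseʷ C) ≡ false
      even = trans (par-++ C₀ (reverseʷ C)) (cong₂ _xor_ odd₀ (trans (par-reverse C) odd))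
      simplify : ∀ a c → a + -[1+ 0 ] * - (-[1+ 0 ] * c) ≡ a - c
      simplify = solve-∀
      rearrange : ∀ a c → a + + 0 ≡ c + (a - c)
      rearrange = solve-∀
      identity : altʷ C₀ + + 0 ≡ altʷ C + altʷ (C₀ ++ʷ reverseʷ C)
      identity = begin
        altʷ C₀ + + 0                                              ≡⟨ rearrange (altʷ C₀) (altʷ C) ⟩
        altʷ C + (altʷ C₀ - altʷ C)                                ≡⟨ cong (λ s → altʷ C + s) (simplify (altʷ C₀) (altʷ C)) ⟨
        altʷ C + (altʷ C₀ + -[1+ 0 ] * - (-[1+ 0 ] * altʷ C))      ≡⟨ cong₂ (λ p q → altʷ C + (altʷ C₀ + sign p * - (sign q * altʷ C))) odd₀ odd ⟨
        altʷ C + (altʷ C₀ + sign (par C₀) * - (sign (par C) * altʷ C)) ≡⟨ cong (λ s → altʷ C + (altʷ C₀ + sign (par C₀) * s)) (alt-reverse C) ⟨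
        altʷ C + (altʷ C₀ + sign (par C₀) * altʷ (reverseʷ C))     ≡⟨ cong (λ s → altʷ C + s) (alt-++ C₀ (reverseʷ C)) ⟨
        altʷ C + altʷ (C₀ ++ʷ reverseʷ C)                          ∎
        where open ≡-Reasoning

    halfAt : ∀ ρ → Maybe (Route ρ (ρ , true)) → ℤ
    halfAt ρ nothing         = + 0
    halfAt ρ (just (C , odd)) = proj₁ (halve C odd)

    T : Fin n → ℤ
    T ρ = halfAt ρ (reach ρ (ρ , true))

    T-halves : ∀ {ρ} (C : HWalk ρ ρ) → par C ≡ true → T ρ + T ρ ≈ altʷ C
    T-halves {ρ} C odd = halves (reach ρ (ρ , true)) (subst (λ p → Known (reach ρ (ρ , p))) odd (reach-complete ρ C))
      where
      halves : (m : Maybe (Route ρ (ρ , true))) → Known m → halfAt ρ m + halfAt ρ m ≈ altʷ C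
      halves (just (C₀ , odd₀)) _ = ≈-trans (proj₂ (halve C₀ odd₀)) (odd-closed-agree C₀ C odd₀ odd)

    edge-from-root : ∀ {ρ₁ ρ₂ u w} → ρ₁ ≡ ρ₂ → (Wu : HWalk ρ₁ u) (Ww : HWalk ρ₂ w) →
                     ∀ {e l} → f e ≡ just l → Joins G e u w →
                     + toℕ l ≈ sign (par Wu) * (T ρ₁ - altʷ Wu) + sign (par Ww) * (T ρ₂ - altʷ Ww)
    edge-from-root {ρ} refl Wu Ww {e} {l} fe j =
      edge-identity (par Wu) (par Ww) (T ρ) (altʷ Wu) (altʷ Ww) (+ toℕ l)
        (λ even → ≈-trans (≡⇒≈ (sym alt-C)) (even-closed ecp C (trans par-C even)))
        (λ odd → ≈-trans (T-halves C (trans par-C odd)) (≡⇒≈ alt-C))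
      where
      C : HWalk ρ ρ
      C = Wu ++ʷ via e l fe j (reverseʷ Ww)
      par-C : par C ≡ par Wu xor not (par Ww)
      par-C = trans (par-++ Wu _) (cong (λ p → par Wu xor not p) (par-reverse Ww))
      alt-C : altʷ C ≡ altʷ Wu + sign (par Wu) * (+ toℕ l - - (sign (par Ww) * altʷ Ww))
      alt-C = trans (alt-++ Wu _) (cong (λ s → altʷ Wu + sign (par Wu) * (+ toℕ l - s)) (alt-reverse Ww))

    potential : Fin n → ℤ
    potential x = sign (par (rootWalk x)) * (T (root x) - altʷ (rootWalk x))

    potential-ok : IsPotential d G f potential
    potential-ok e l fe = edge-from-root (root-edge fe j) (rootWalk (src e)) (rootWalk (tgt e)) fe j
      where
      j : Joins G e (src e) (tgt e)
      j = inj₁ (refl , refl)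

  has-potential : Compatible G d f → Σ (Fin n → ℤ) (IsPotential d G f)
  has-potential compat = potential ecp (halvable compat) , potential-ok ecp (halvable compat)
    where
    ecp : EvenCycleProperty G d f
    ecp = even-cycle-property compat

module Extension (d : ℕ) .{{_ : NonZero d}} (G : Graph) (f : Fin (Graph.m G) → Maybe (Fin d))
                 (π : Fin (Graph.n G) → ℤ) (π-ok : IsPotential d G f π) where
  open Graph G
  open Congruence d

  residue : Fin n → ℕ
  residue x = π x ℤ.%ℕ d

  B : Fin n → ℤ
  B x = + residue x

  B≈π : ∀ x → B x ≈ π x
  B≈π x = ≈-sym (≈-by (π x ℤ./ℕ d) (a≡a%ℕn+[a/ℕn]*n (π x) d))

  fE : Fin m → Fin d
  fE e = (residue (src e) ℕ.+ residue (tgt e)) mod d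

  fE≈ : ∀ e → + toℕ (fE e) ≈ B (src e) + B (tgt e)
  fE≈ e = ≈-trans (%⇒≈ (trans (cong (ℕ._% d) (FinP.toℕ-fromℕ< _)) (m%n%n≡m%n _ d)))
                  (≡⇒≈ (ℤP.pos-+ (residue (src e)) (residue (tgt e))))

  -- labels are determined by their residues, and f(e) ≡ π(src e) + π(tgt e) ≡ fE(e)
  fE-extends : ∀ e l → f e ≡ just l → fE e ≡ l
  fE-extends e l fe = FinP.toℕ-injective (begin
      toℕ (fE e)           ≡⟨ m<n⇒m%n≡m (FinP.toℕ<n (fE e)) ⟨
      toℕ (fE e) ℕ.% d     ≡⟨ ≈⇒% same-residue ⟩
      toℕ l ℕ.% d          ≡⟨ m<n⇒m%n≡m (FinP.toℕ<n l) ⟩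
      toℕ l                ∎)
    where
    open ≡-Reasoning
    same-residue : + toℕ (fE e) ≈ + toℕ l
    same-residue = ≈-trans (fE≈ e) (≈-trans (≈-+ (B≈π (src e)) (B≈π (tgt e))) (≈-sym (π-ok e l fe)))

  g : Fin m → Maybe (Fin d)
  g e = just (fE e)

  Labelled : List (Fin m) → List (Fin d) → Set
  Labelled = Pointwise (λ e l → g e ≡ just l)

  label≈ : ∀ {e u w l} → Joins G e u w → g e ≡ just l → + toℕ l ≈ B u + B w
  label≈ {e} (inj₁ (refl , refl)) refl = fE≈ e
  label≈ {e} (inj₂ (refl , refl)) refl = ≈-trans (fE≈ e) (≡⇒≈ (ℤP.+-comm (B (src e)) (B (tgt e))))

  private
    alt-nil : ∀ b → + 0 ≡ b - + 1 * b
    alt-nil = solve-∀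
    alt-cons : ∀ u w s x → (u + w) + - (w - s * x) ≡ u - (- s) * x
    alt-cons = solve-∀
    sum-nil : ∀ b → + 0 ≡ b + b + (- b + - b)
    sum-nil = solve-∀
    sum-cons : ∀ l u w x S → l + (w + x + (S + S)) ≡ (l - (u + w)) + (u + x + ((S + w) + (S + w)))
    sum-cons = solve-∀
    cancel : ∀ l s → (l - s) + s ≡ + 0 + l
    cancel = solve-∀

  alt-telescopes : ∀ {v x es ls} → Walk G v x es → Labelled es ls →
                   alt ls ≈ B v - sign (parity (length es)) * B x
  alt-telescopes {v} nil [] = ≡⇒≈ (alt-nil (B v))
  alt-telescopes {v} {x} {_ ∷ es} {l ∷ ls} (cons {w = w} j W) (ge ∷ labelled) = begin
      + toℕ l - alt ls                                         ≈⟨ ≈-+ (label≈ j ge) (≈-neg (alt-telescopes W labelled)) ⟩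
      (B v + B w) - (B w - sign (parity (length es)) * B x)    ≡⟨ alt-cons (B v) (B w) (sign (parity (length es))) (B x) ⟩
      B v - (- sign (parity (length es))) * B x                ≡⟨ cong (λ s → B v - s * B x) (sign-not (parity (length es))) ⟨
      B v - sign (not (parity (length es))) * B x              ∎
    where open ≈-Reasoning

  sum-telescopes : ∀ {v x es ls} → Walk G v x es → Labelled es ls →
                   Σ ℤ λ S → + labelSum ls ≈ B v + B x + (S + S)
  sum-telescopes {v} nil [] = - B v , ≡⇒≈ (sum-nil (B v))
  sum-telescopes {v} {x} {ls = l ∷ ls} (cons {w = w} j W) (ge ∷ labelled) with sum-telescopes W labelled
  ... | S , sum≈ = S + B w , (begin
      + (toℕ l ℕ.+ labelSum ls)                               ≡⟨ ℤP.pos-+ (toℕ l) (labelSum ls) ⟩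
      + toℕ l + + labelSum ls                                 ≈⟨ ≈-+ (≈-refl {+ toℕ l}) sum≈ ⟩
      + toℕ l + (B w + B x + (S + S))                         ≡⟨ sum-cons (+ toℕ l) (B v) (B w) (B x) S ⟩
      (+ toℕ l - (B v + B w)) + (B v + B x + ((S + B w) + (S + B w)))
          ≈⟨ ≈-+ (≈-shift {L = + toℕ l - (B v + B w)} {R = + 0} (label≈ j ge) (cancel (+ toℕ l) (B v + B w))) (≈-refl {B v + B x + ((S + B w) + (S + B w))}) ⟩
      + 0 + (B v + B x + ((S + B w) + (S + B w)))             ≡⟨ ℤP.+-identityˡ _ ⟩
      B v + B x + ((S + B w) + (S + B w))                     ∎)
    where open ≈-Reasoning

  even-cycles : EvenCycleProperty G d g
  even-cycles v es ls W _ even labelled = ≈⇒% (≈-shift alt≈0 (regroup (+ oddSum ls) (+ evenSum ls)))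
    where
    vanish : ∀ b → b - + 1 * b ≡ + 0
    vanish = solve-∀
    regroup : ∀ o e → o + + 0 ≡ e + (o - e)
    regroup = solve-∀
    alt≈0 : + oddSum ls - + evenSum ls ≈ + 0
    alt≈0 = begin
      + oddSum ls - + evenSum ls                   ≡⟨ alt-split ls ⟨
      alt ls                                       ≈⟨ alt-telescopes W labelled ⟩
      B v - sign (parity (length es)) * B v        ≡⟨ cong (λ p → B v - sign p * B v) (parity-even (length es) even) ⟩
      B v - + 1 * B v                              ≡⟨ vanish (B v) ⟩
      + 0                                          ∎
      where open ≈-Reasoning

  -- for d = 2q: q · (2B(v) + 2S) = (B(v) + S) · d ≡ 0
  odd-cycles : d ℕ.% 2 ≡ 0 → OddCycleProperty G d g
  odd-cycles d-even v es ls W _ labelled with sum-telescopes W labelled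
  ... | S , sum≈ = trans (≈⇒% (begin
      + (q ℕ.* labelSum ls)                   ≡⟨ ℤP.pos-* q (labelSum ls) ⟩
      + q * + labelSum ls                     ≈⟨ ≈-* (+ q) sum≈ ⟩
      + q * (B v + B v + (S + S))             ≡⟨ factor (+ q) (B v) S ⟩
      (B v + S) * (+ q * + 2)                 ≡⟨ cong ((B v + S) *_) D≡2q ⟨
      (B v + S) * D                           ≈⟨ multiple≈0 (B v + S) ⟩
      + 0                                     ∎)) (m<n⇒m%n≡m (ℕ.>-nonZero⁻¹ d))
    where
    open ≈-Reasoning
    q : ℕ
    q = d ℕ./ 2
    D≡2q : D ≡ + q * + 2
    D≡2q = trans (cong +_ (trans (m≡m%n+[m/n]*n d 2) (cong (ℕ._+ q ℕ.* 2) d-even))) (ℤP.pos-* q 2)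
    factor : ∀ q b S → q * (b + b + (S + S)) ≡ (b + S) * (q * + 2)
    factor = solve-∀

  compatible : Compatible G d g
  compatible with %2-cases d
  ... | inj₁ d-odd  = inj₁ (d-odd , even-cycles)
  ... | inj₂ d-even = inj₂ (d-even , even-cycles , odd-cycles d-even)

corollary2 : (d : ℕ) .{{_ : NonZero d}} (G : Graph) (f : Fin (Graph.m G) → Maybe (Fin d)) →
    Compatible G d f →
    Σ (Fin (Graph.m G) → Fin d) λ fE →
      (∀ e l → f e ≡ just l → fE e ≡ l) × Compatible G d (λ e → just (fE e))
corollary2 d G f compat with PotentialConstruction.has-potential d G f compat
... | π , π-ok = fE , fE-extends , compatible
  where open Extension d G f π π-ok
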